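{- Let $H_{\mathrm{gr}}(z) := \sum_{h\ge0}\#\mathcal{D}^*(\mathfrak{l}_h)\,z^h$ and $H_{\mathrm{ni}}(z) := \sum_{h\ge0}e_h\,z^h$, where $e_h$ is the number of pairs $(\mathfrak{f},\mathfrak{f}')$ of elements of $\mathcal{D}^*(\mathfrak{l}_h)$ with $\mathfrak{f}\lessdot\mathfrak{f}'$ (the number of edges of the Hasse diagram of $\mathcal{D}^*(\mathfrak{l}_h)$). Then $$H_{\mathrm{ni}} = z\,H_{\mathrm{ni}} + z\,H_{\mathrm{gr}} + 2z\,(H_{\mathrm{ni}}\boxtimes H_{\mathrm{gr}}).$$
   Context: A duplicative forest is a finite word of duplicative trees (empty word $\epsilon$ allowed); a duplicative tree is $\circ(\mathfrak{g})$ or $\bullet(\mathfrak{g})$ for a duplicative forest $\mathfrak{g}$; $\cdot$ is concatenation. $\mathfrak{f}\lessdot\mathfrak{f}'$ iff $\mathfrak{f}'$ is obtained from $\mathfrak{f}$ by replacing one subtree $\circ(\mathfrak{g})$ by $\bullet(\mathfrak{g}\cdot\mathfrak{g})$ (this is the covering relation of the order $\ll$, its reflexive transitive closure); $\mathcal{D}^*(\mathfrak{f}) := \{\mathfrak{f}' : \mathfrak{f}\ll\mathfrak{f}'\}$. Ladders: $\mathfrak{l}_0:=\epsilon$, $\mathfrak{l}_h:=\circ(\mathfrak{l}_{h-1})$. Hadamard product: $(\sum_n a_nz^n)\boxtimes(\sum_n b_nz^n) := \sum_n a_nb_nz^n$. -}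

module Defs where

open import Data.Nat using (ℕ; zero; suc; _+_; _*_)
open import Data.List using (List; []; _∷_; _++_; length)
open import Data.List.Membership.Propositional using (_∈_)
open import Data.List.Relation.Unary.Unique.Propositional using (Unique)
open import Data.Product using (Σ; _×_; proj₁; proj₂)
open import Function.Bundles using (_⇔_)
open import Relation.Binary.PropositionalEquality using (_≡_)
open import Relation.Binary.Construct.Closure.ReflexiveTransitive using (Star)

-- Duplicative trees and forests.
-- ○ g  is  ∘(g)   and   ● g  is  •(g).
data Tree : Set where
  ○ : List Tree → Tree
  ● : List Tree → Tree

Forest : Set
Forest = List Tree

mutual
  data _⋖_ : Forest → Forest → Set where
    here  : ∀ {t t' ts} → t ⋖T t' → (t ∷ ts) ⋖ (t' ∷ ts)
    there : ∀ {t ts ts'} → ts ⋖ ts' → (t ∷ ts) ⋖ (t ∷ ts')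

  data _⋖T_ : Tree → Tree → Set where
    dup   : ∀ g → ○ g ⋖T ● (g ++ g)
    in○   : ∀ {g g'} → g ⋖ g' → ○ g ⋖T ○ g'
    in●   : ∀ {g g'} → g ⋖ g' → ● g ⋖T ● g'

_≪_ : Forest → Forest → Set
_≪_ = Star _⋖_

ladder : ℕ → Forest
ladder zero    = []
ladder (suc h) = ○ (ladder h) ∷ []

HasCard : {A : Set} → (A → Set) → ℕ → Set
HasCard {A} P n =
  Σ (List A) λ L → Unique L × length L ≡ n × (∀ x → (x ∈ L) ⇔ P x)

InD* : ℕ → Forest → Set
InD* h f = ladder h ≪ f

IsEdge : ℕ → Forest × Forest → Set
IsEdge h p = InD* h (proj₁ p) × InD* h (proj₂ p) × (proj₁ p ⋖ proj₂ p)

FPS : Set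
FPS = ℕ → ℕ

z·_ : FPS → FPS
(z· F) zero    = 0
(z· F) (suc n) = F n

_⊕_ : FPS → FPS → FPS
(F ⊕ G) n = F n + G n

_·_ : ℕ → FPS → FPS
(c · F) n = c * F n

_⊠_ : FPS → FPS → FPS
(F ⊠ G) n = F n * G n

infixr 9 z·_
infixl 7 _⊠_
infixr 8 _·_
infixl 6 _⊕_

{-# OPTIONS --safe #-}
-- Every element of D*(l (h+1)) is either ∘(f) or •(f · f') with f, f' in D*(l h), and
-- these are all distinct. A cover of ∘(f) either happens inside f or is the duplication
-- ∘(f) ⋖ •(f · f); a cover of •(f · f') happens inside f or inside f'. Encoding elements
-- and covers by these case distinctions gives g (h+1) = g h + (g h)² for the number g h
-- of elements and e (h+1) = e h + g h + 2 e h g h for the number e h of covers, which is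
-- the stated identity coefficientwise.
module Submission where

open import Defs
open import Data.Product using (Σ; _×_)
open import Relation.Binary.PropositionalEquality using (_≗_)

open import Data.Empty using (⊥; ⊥-elim)
open import Data.Fin using (Fin)
open import Data.Fin.Properties using (0↔⊥; 1↔⊤; +↔⊎; *↔×)
open import Data.List using (List; []; _∷_; _++_; length; map; allFin)
open import Data.List.Membership.Propositional using (_∈_)
open import Data.List.Membership.Propositional.Properties using (∈-map⁺; ∈-map⁻; ∈-allFin)
open import Data.List.Properties using (∷-injective; ∷-injectiveˡ; length-map; length-tabulate)
import Data.List.Relation.Unary.Unique.Propositional.Properties as Unique
open import Data.Nat using (ℕ; zero; suc; pred; _+_; _*_)
open import Data.Nat.Tactic.RingSolver using (solve-∀)
open import Data.Product using (∃; _,_; proj₁; proj₂)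
open import Data.Product.Function.NonDependent.Propositional using (_×-↔_)
open import Data.Product.Properties using (,-injectiveˡ; ,-injectiveʳ)
open import Data.Sum using (_⊎_; inj₁; inj₂)
open import Data.Sum.Function.Propositional using (_⊎-↔_)
open import Data.Sum.Properties using (inj₁-injective)
open import Data.Unit using (⊤; tt)
open import Function using (_∘_)
open import Function.Bundles using (_↔_; Inverse; Injection; mk⇔)
open import Function.Definitions using (Injective)
open import Function.Properties.Inverse using (↔-trans; ↔⇒↣)
open import Relation.Binary.Construct.Closure.ReflexiveTransitive using (ε; _◅_; _◅◅_; gmap)
open import Relation.Binary.PropositionalEquality using (_≡_; refl; sym; trans; cong; cong₂; subst)
open import Relation.Nullary using (¬_)

hasCard-image : ∀ {A B : Set} {n} {P : B → Set} → Fin n ↔ A → (f : A → B) → Injective _≡_ _≡_ f →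
                (∀ a → P (f a)) → (∀ b → P b → ∃ λ a → f a ≡ b) → HasCard P n
hasCard-image {B = B} {n} {P} enum f f-injective f-sound f-complete =
  map encode (allFin n) ,
  Unique.map⁺ encode-injective (Unique.allFin⁺ n) ,
  trans (length-map encode (allFin n)) (length-tabulate (λ i → i)) ,
  λ b → mk⇔ (sound b) (complete b)
  where
  open Inverse enum using (to; from; strictlyInverseˡ)
  encode : Fin n → B
  encode = f ∘ to
  encode-injective : Injective _≡_ _≡_ encode
  encode-injective = Injection.injective (↔⇒↣ enum) ∘ f-injective
  sound : ∀ b → b ∈ map encode (allFin n) → P b
  sound b b∈ with ∈-map⁻ encode b∈
  ... | i , _ , refl = f-sound (to i)
  complete : ∀ b → P b → b ∈ map encode (allFin n)
  complete b Pb with f-complete b Pb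
  ... | a , refl = subst (λ x → f x ∈ map encode (allFin n)) (strictlyInverseˡ a)
                         (∈-map⁺ encode (∈-allFin (from a)))

++-injective-≡length : ∀ {A : Set} (xs ys : List A) {zs ws} → length xs ≡ length ys →
                       xs ++ zs ≡ ys ++ ws → xs ≡ ys × zs ≡ ws
++-injective-≡length []       []       _   eq = refl , eq
++-injective-≡length (x ∷ xs) (y ∷ ys) len eq with ∷-injective eq
... | refl , eq′ with ++-injective-≡length xs ys (cong pred len) eq′
...   | refl , refl = refl , refl

○-injective : ∀ {f f'} → ○ f ≡ ○ f' → f ≡ f'
○-injective refl = refl

●-injective : ∀ {f f'} → ● f ≡ ● f' → f ≡ f'
●-injective refl = refl

⋖-++-congʳ : ∀ {f f'} g → f ⋖ f' → (f ++ g) ⋖ (f' ++ g)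
⋖-++-congʳ g (here c)  = here c
⋖-++-congʳ g (there c) = there (⋖-++-congʳ g c)

⋖-++-congˡ : ∀ f {g g'} → g ⋖ g' → (f ++ g) ⋖ (f ++ g')
⋖-++-congˡ []      c = c
⋖-++-congˡ (t ∷ f) c = there (⋖-++-congˡ f c)

⋖-++-inv : ∀ f {g x} → (f ++ g) ⋖ x →
           (∃ λ f' → f ⋖ f' × x ≡ f' ++ g) ⊎ (∃ λ g' → g ⋖ g' × x ≡ f ++ g')
⋖-++-inv []      {x = x} c = inj₂ (x , c , refl)
⋖-++-inv (t ∷ f) (here {t' = t'} c) = inj₁ (t' ∷ f , here c , refl)
⋖-++-inv (t ∷ f) (there c) with ⋖-++-inv f c
... | inj₁ (f' , c' , refl) = inj₁ (t ∷ f' , there c' , refl)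
... | inj₂ (g' , c' , refl) = inj₂ (g' , c' , refl)

-- Shape h encodes D*(l h) through forest h, and Cover h its covering pairs through
-- source h and target h.
Shape : ℕ → Set
Shape zero    = ⊤
Shape (suc h) = Shape h ⊎ (Shape h × Shape h)

pattern ○ₛ s   = inj₁ s
pattern ●ₛ a b = inj₂ (a , b)

Cover : ℕ → Set
Cover zero    = ⊥
Cover (suc h) = Cover h ⊎ (Shape h ⊎ ((Cover h × Shape h) ⊎ (Shape h × Cover h)))

pattern in○ₑ e    = inj₁ e
pattern dupₑ s    = inj₂ (inj₁ s)
pattern in●ˡₑ e b = inj₂ (inj₂ (inj₁ (e , b)))
pattern in●ʳₑ a e = inj₂ (inj₂ (inj₂ (a , e)))

#Shape : ℕ → ℕ
#Shape zero    = 1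
#Shape (suc h) = #Shape h + #Shape h * #Shape h

#Cover : ℕ → ℕ
#Cover zero    = 0
#Cover (suc h) = #Cover h + (#Shape h + (#Cover h * #Shape h + #Shape h * #Cover h))

Shape-enum : ∀ h → Fin (#Shape h) ↔ Shape h
Shape-enum zero    = 1↔⊤
Shape-enum (suc h) =
  ↔-trans +↔⊎ (Shape-enum h ⊎-↔ ↔-trans *↔× (Shape-enum h ×-↔ Shape-enum h))

Cover-enum : ∀ h → Fin (#Cover h) ↔ Cover h
Cover-enum zero    = 0↔⊥
Cover-enum (suc h) =
  ↔-trans +↔⊎ (Cover-enum h ⊎-↔ ↔-trans +↔⊎ (Shape-enum h ⊎-↔ ↔-trans +↔⊎
    (↔-trans *↔× (Cover-enum h ×-↔ Shape-enum h) ⊎-↔ ↔-trans *↔× (Shape-enum h ×-↔ Cover-enum h))))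

mutual
  forest : ∀ h → Shape h → Forest
  forest zero    _ = []
  forest (suc h) s = tree h s ∷ []

  tree : ∀ h → Shape (suc h) → Tree
  tree h (○ₛ s)   = ○ (forest h s)
  tree h (●ₛ a b) = ● (forest h a ++ forest h b)

source : ∀ h → Cover h → Shape h
source (suc h) (in○ₑ e)    = ○ₛ (source h e)
source (suc h) (dupₑ s)    = ○ₛ s
source (suc h) (in●ˡₑ e b) = ●ₛ (source h e) b
source (suc h) (in●ʳₑ a e) = ●ₛ a (source h e)

target : ∀ h → Cover h → Shape h
target (suc h) (in○ₑ e)    = ○ₛ (target h e)
target (suc h) (dupₑ s)    = ●ₛ s s
target (suc h) (in●ˡₑ e b) = ●ₛ (target h e) b
target (suc h) (in●ʳₑ a e) = ●ₛ a (target h e)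

length-forest : ∀ h (s s' : Shape h) → length (forest h s) ≡ length (forest h s')
length-forest zero    _ _ = refl
length-forest (suc h) _ _ = refl

mutual
  forest-injective : ∀ h → Injective _≡_ _≡_ (forest h)
  forest-injective zero    {tt} {tt} _ = refl
  forest-injective (suc h) eq = tree-injective h (∷-injectiveˡ eq)

  tree-injective : ∀ h → Injective _≡_ _≡_ (tree h)
  tree-injective h {○ₛ s}   {○ₛ s'}    eq = cong ○ₛ (forest-injective h (○-injective eq))
  tree-injective h {●ₛ a b} {●ₛ a' b'} eq
    with ++-injective-≡length (forest h a) (forest h a') (length-forest h a a') (●-injective eq)
  ... | a≡a' , b≡b' = cong₂ ●ₛ (forest-injective h a≡a') (forest-injective h b≡b')

●ₛ-injective : ∀ {A B C : Set} {a a' : A} {b b' : B} →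
               inj₂ {A = C} (a , b) ≡ inj₂ (a' , b') → a ≡ a' × b ≡ b'
●ₛ-injective refl = refl , refl

source≢target : ∀ h e → ¬ source h e ≡ target h e
source≢target (suc h) (in○ₑ e)    eq = source≢target h e (inj₁-injective eq)
source≢target (suc h) (in●ˡₑ e _) eq = source≢target h e (proj₁ (●ₛ-injective eq))
source≢target (suc h) (in●ʳₑ _ e) eq = source≢target h e (proj₂ (●ₛ-injective eq))

endpoints-injective : ∀ h e e' → source h e ≡ source h e' → target h e ≡ target h e' → e ≡ e'
endpoints-injective (suc h) (in○ₑ e) (in○ₑ e') p q =
  cong in○ₑ (endpoints-injective h e e' (inj₁-injective p) (inj₁-injective q))
endpoints-injective (suc h) (in○ₑ _)    (dupₑ _)      _ ()
endpoints-injective (suc h) (in○ₑ _)    (in●ˡₑ _ _)   () _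
endpoints-injective (suc h) (in○ₑ _)    (in●ʳₑ _ _)   () _
endpoints-injective (suc h) (dupₑ _)    (in○ₑ _)      _ ()
endpoints-injective (suc h) (dupₑ _)    (dupₑ _)      refl _ = refl
endpoints-injective (suc h) (dupₑ _)    (in●ˡₑ _ _)   () _
endpoints-injective (suc h) (dupₑ _)    (in●ʳₑ _ _)   () _
endpoints-injective (suc h) (in●ˡₑ _ _) (in○ₑ _)      () _
endpoints-injective (suc h) (in●ˡₑ _ _) (dupₑ _)      () _
endpoints-injective (suc h) (in●ˡₑ e b) (in●ˡₑ e' b') p q
  with ●ₛ-injective p | ●ₛ-injective q
... | p₁ , refl | q₁ , _ = cong (λ x → in●ˡₑ x b) (endpoints-injective h e e' p₁ q₁)
endpoints-injective (suc h) (in●ˡₑ e _) (in●ʳₑ _ _) p q =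
  ⊥-elim (source≢target h e (trans (proj₁ (●ₛ-injective p)) (sym (proj₁ (●ₛ-injective q)))))
endpoints-injective (suc h) (in●ʳₑ _ _) (in○ₑ _)      () _
endpoints-injective (suc h) (in●ʳₑ _ _) (dupₑ _)      () _
endpoints-injective (suc h) (in●ʳₑ _ _) (in●ˡₑ e _) p q =
  ⊥-elim (source≢target h e (trans (sym (proj₁ (●ₛ-injective p))) (proj₁ (●ₛ-injective q))))
endpoints-injective (suc h) (in●ʳₑ a e) (in●ʳₑ a' e') p q
  with ●ₛ-injective p | ●ₛ-injective q
... | refl , p₂ | _ , q₂ = cong (in●ʳₑ a) (endpoints-injective h e e' p₂ q₂)

cover-sound : ∀ h e → forest h (source h e) ⋖ forest h (target h e)
cover-sound (suc h) (in○ₑ e)    = here (in○ (cover-sound h e))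
cover-sound (suc h) (dupₑ s)    = here (dup (forest h s))
cover-sound (suc h) (in●ˡₑ e b) = here (in● (⋖-++-congʳ (forest h b) (cover-sound h e)))
cover-sound (suc h) (in●ʳₑ a e) = here (in● (⋖-++-congˡ (forest h a) (cover-sound h e)))

cover-complete : ∀ h s {x} → forest h s ⋖ x → ∃ λ e → source h e ≡ s × forest h (target h e) ≡ x
cover-complete (suc h) (○ₛ s) (here (dup _)) = dupₑ s , refl , refl
cover-complete (suc h) (○ₛ s) (here (in○ c)) with cover-complete h s c
... | e , refl , refl = in○ₑ e , refl , refl
cover-complete (suc h) (●ₛ a b) (here (in● c)) with ⋖-++-inv (forest h a) c
... | inj₁ (_ , c′ , refl) with cover-complete h a c′
...   | e , refl , refl = in●ˡₑ e b , refl , refl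
cover-complete (suc h) (●ₛ a b) (here (in● c)) | inj₂ (_ , c′ , refl) with cover-complete h b c′
...   | e , refl , refl = in●ʳₑ a e , refl , refl

ladder-shape : ∀ h → Shape h
ladder-shape zero    = tt
ladder-shape (suc h) = ○ₛ (ladder-shape h)

forest-ladder-shape : ∀ h → forest h (ladder-shape h) ≡ ladder h
forest-ladder-shape zero    = refl
forest-ladder-shape (suc h) = cong (λ f → ○ f ∷ []) (forest-ladder-shape h)

ladder≪forest : ∀ h s → ladder h ≪ forest h s
ladder≪forest zero    tt       = ε
ladder≪forest (suc h) (○ₛ s)   = gmap (λ f → ○ f ∷ []) (λ c → here (in○ c)) (ladder≪forest h s)
ladder≪forest (suc h) (●ₛ a b) =
  here (dup (ladder h)) ◅ gmap (λ f → ● f ∷ []) (λ c → here (in● c))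
    (gmap (_++ ladder h) (⋖-++-congʳ (ladder h)) (ladder≪forest h a)
     ◅◅ gmap (forest h a ++_) (⋖-++-congˡ (forest h a)) (ladder≪forest h b))

≪-preserves-forest : ∀ h {f f'} → f ≪ f' → (∃ λ s → forest h s ≡ f) → ∃ λ s → forest h s ≡ f'
≪-preserves-forest h ε             decoded        = decoded
≪-preserves-forest h (c ◅ steps) (s , refl) with cover-complete h s c
... | e , _ , eq = ≪-preserves-forest h steps (target h e , eq)

D*-forest : ∀ h {f} → InD* h f → ∃ λ s → forest h s ≡ f
D*-forest h f∈D* = ≪-preserves-forest h f∈D* (ladder-shape h , forest-ladder-shape h)

card-D* : ∀ h → HasCard (InD* h) (#Shape h)
card-D* h = hasCard-image (Shape-enum h) (forest h) (forest-injective h)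
  (ladder≪forest h) (λ _ → D*-forest h)

endpoints : ∀ h → Cover h → Forest × Forest
endpoints h e = forest h (source h e) , forest h (target h e)

endpoints-forest-injective : ∀ h → Injective _≡_ _≡_ (endpoints h)
endpoints-forest-injective h {e} {e'} eq = endpoints-injective h e e'
  (forest-injective h (,-injectiveˡ eq)) (forest-injective h (,-injectiveʳ eq))

card-edges : ∀ h → HasCard (IsEdge h) (#Cover h)
card-edges h = hasCard-image (Cover-enum h) (endpoints h) (endpoints-forest-injective h)
  (λ e → ladder≪forest h (source h e) , ladder≪forest h (target h e) , cover-sound h e)
  edge-endpoints
  where
  edge-endpoints : ∀ p → IsEdge h p → ∃ λ e → endpoints h e ≡ p
  edge-endpoints (f , f') (f∈D* , _ , c) with D*-forest h f∈D*
  ... | s , refl with cover-complete h s c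
  ...   | e , refl , refl = e , refl

proposition3p4p6 : Σ FPS λ Hgr → Σ FPS λ Hni → ((h : _) → HasCard (InD* h) (Hgr h)) × ((h : _) → HasCard (IsEdge h) (Hni h)) × (Hni ≗ z· Hni ⊕ z· Hgr ⊕ 2 · z· (Hni ⊠ Hgr))
proposition3p4p6 = #Shape , #Cover , card-D* , card-edges , recurrence
  where
  recurrence : #Cover ≗ z· #Cover ⊕ z· #Shape ⊕ 2 · z· (#Cover ⊠ #Shape)
  recurrence zero    = refl
  recurrence (suc h) = arithmetic (#Cover h) (#Shape h)
    where
    arithmetic : ∀ e g → e + (g + (e * g + g * e)) ≡ e + g + 2 * (e * g)
    arithmetic = solve-∀
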